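{- For every $n\ge 0$, $\mathcal{P}_2(n) = n+1$, where $\mathcal{P}_2(n) = \max\{ |\mathrm{Pal}(T)| : T \in \mathcal{T}_2,\ |T| \le n\}$.
   Context: Fix a finite alphabet $\Sigma$. A tree is a finite undirected, acyclic, connected graph whose edges are labeled by letters of $\Sigma$. For nodes $x,y$, $\pi(x,y)$ is the word of labels along the unique simple path from $x$ to $y$ ($\pi(x,x)$ is the empty word). $\mathcal{L}(T)=\{\pi(x,y)\}$ over all pairs of nodes, $\mathrm{Pal}(T)$ is the set of palindromes (words equal to their reversal, including the empty word) in $\mathcal{L}(T)$, and $|T|$ is the number of edges. For a word $w$, $|\Delta(w)|$ is the number of maximal blocks of equal consecutive letters of $w$. $\mathcal{T}_k$ is the set of labeled trees $T$ with $|\Delta(f)|\le k$ for all $f\in\mathcal{L}(T)$. -}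

module Defs where

open import Data.Nat using (ℕ; zero; suc; _+_; _≤_)
open import Data.Fin using (Fin; zero; suc; toℕ; inject≤)
open import Data.Fin.Properties using (_≟_)
open import Data.List using (List; []; _∷_; length; reverse)
open import Data.List.Membership.Propositional using (_∈_)
open import Data.List.Relation.Unary.Unique.Propositional using (Unique)
open import Data.Product using (Σ; ∃; _×_; _,_)
open import Data.Sum using (_⊎_)
open import Relation.Nullary using (yes; no)
open import Relation.Binary.PropositionalEquality using (_≡_)
open import Function.Bundles using (_⇔_)

Alphabet : ℕ → Set
Alphabet s = Fin (suc s)

-- A labeled tree with m edges, on the node set Fin (suc m), in
-- parent-pointer form: node (suc i) is joined to its parent, a node with
-- index ≤ i, by an edge labeled (label i).  Every finite edge-labeled
-- tree is isomorphic to one of this form (root it at 0 and number the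
-- nodes in BFS order), and each such structure is a tree with m edges.
record Tree (s : ℕ) : Set where
  field
    edges  : ℕ
    parent : (i : Fin edges) → Fin (suc (toℕ i))
    label  : Fin edges → Alphabet s

open Tree public

Node : ∀ {s} → Tree s → Set
Node T = Fin (suc (edges T))

∣_∣ᵀ : ∀ {s} → Tree s → ℕ
∣ T ∣ᵀ = edges T

par : ∀ {s} (T : Tree s) → Fin (edges T) → Node T
par T i = inject≤ (parent T i) (Data.Nat.s≤s (Data.Fin.Properties.toℕ≤n i))
  where import Data.Nat ; import Data.Fin.Properties

data Adj {s} (T : Tree s) : Node T → Node T → Alphabet s → Set where
  up   : (i : Fin (edges T)) → Adj T (suc i) (par T i) (label T i)
  down : (i : Fin (edges T)) → Adj T (par T i) (suc i) (label T i)

data Walk {s} (T : Tree s) : Node T → Node T → List (Alphabet s) → List (Node T) → Set where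
  here : (x : Node T) → Walk T x x [] (x ∷ [])
  step : ∀ {x y z a w vs} → Adj T x y a → Walk T y z w vs → Walk T x z (a ∷ w) (x ∷ vs)

IsPathWord : ∀ {s} (T : Tree s) → Node T → Node T → List (Alphabet s) → Set
IsPathWord T x y w = ∃ λ vs → Walk T x y w vs × Unique vs

InL : ∀ {s} → Tree s → List (Alphabet s) → Set
InL T w = ∃ λ x → ∃ λ y → IsPathWord T x y w

IsPalindrome : ∀ {s} → List (Alphabet s) → Set
IsPalindrome w = w ≡ reverse w

InPal : ∀ {s} → Tree s → List (Alphabet s) → Set
InPal T w = InL T w × IsPalindrome w

blocks-after : ∀ {s} → Alphabet s → List (Alphabet s) → ℕ
blocks-after a [] = 0
blocks-after a (b ∷ w) with a ≟ b
... | yes _ = blocks-after b w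
... | no _  = suc (blocks-after b w)

blocks : ∀ {s} → List (Alphabet s) → ℕ
blocks [] = 0
blocks (a ∷ w) = suc (blocks-after a w)

In𝓣 : ∀ {s} → ℕ → Tree s → Set
In𝓣 k T = ∀ w → InL T w → blocks w ≤ k

HasCard : {A : Set} → (A → Set) → ℕ → Set
HasCard {A} P k = Σ (List A) λ ws → Unique ws × (∀ w → (w ∈ ws) ⇔ P w) × length ws ≡ k

IsMaxPal₂ : (s n m : ℕ) → Set
IsMaxPal₂ s n m =
  (∀ (T : Tree s) → In𝓣 2 T → ∣ T ∣ᵀ ≤ n → ∀ k → HasCard (InPal T) k → k ≤ m)
  × (Σ (Tree s) λ T → In𝓣 2 T × ∣ T ∣ᵀ ≤ n × HasCard (InPal T) m)

module Submission where

-- Nodes are numbered so that parents precede children; add them one at a time.  The new node is a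
-- leaf, so a palindrome read along a path that was not available before can be read starting at
-- that leaf.  In 𝓣₂ a palindrome has at most two blocks and starts and ends with the same letter,
-- so it is a power of the label a of the leaf's edge.  Of two distinct such powers the shorter is
-- read along a suffix of the longer one's path, avoiding the leaf.  Hence each node adds at most
-- one palindrome besides the empty word, so |Pal(T)| ≤ |T| + 1; the unary path a^n attains this.

open import Defs
open import Data.Nat using (ℕ; zero; suc; _≤_; _<_; _∸_; z≤n; s≤s; s≤s⁻¹; _≤?_)
open import Data.Nat.Properties
  using (≤-refl; ≤-reflexive; ≤-trans; n≤1+n; m≤n⇒m≤1+n; m≤n⇒m<n∨m≡n; ≰⇒>; n≮n; <-cmp; suc-injective; m∸n≤m; m∸[m∸n]≡n)
open import Data.Fin using (Fin; zero; suc; toℕ; fromℕ; fromℕ<)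
open import Data.Fin.Properties using (_≟_; toℕ-injective; toℕ<n; toℕ-fromℕ; toℕ-fromℕ<; toℕ-inject≤; pigeonhole)
import Data.Fin.Properties as Fin
open import Data.List using (List; []; _∷_; _∷ʳ_; length; reverse; reverseAcc; drop; replicate; map; upTo; lookup)
open import Data.List.Properties
  using (∷-injectiveʳ; unfold-reverse; length-drop; length-reverse; length-replicate; length-map; length-upTo)
open import Data.List.Relation.Unary.All as All using (All; []; _∷_)
open import Data.List.Relation.Unary.All.Properties using (¬Any⇒All¬; ++⁺; drop⁺; replicate⁺)
open import Data.List.Relation.Unary.Any using (here; there)
open import Data.List.Relation.Unary.Unique.Propositional using (Unique; []; _∷_)
open import Data.List.Relation.Unary.Unique.Propositional.Properties as Unique using (Unique[x∷xs]⇒x∉xs)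
open import Data.List.Membership.Propositional using (_∈_; _∉_)
open import Data.List.Membership.Propositional.Properties using (∈-lookup; ∈-map⁺; ∈-map⁻; ∈-upTo⁺; ∈-upTo⁻)
import Data.List.Membership.DecPropositional as DecMembership
open import Data.List.Relation.Binary.Subset.Propositional using (_⊆_)
open import Data.List.Relation.Binary.Subset.Propositional.Properties using (⊆-trans; xs⊆x∷xs; ∷⁺ʳ; ∈-∷⁺ʳ)
open import Data.List.Relation.Binary.Permutation.Propositional using (↭-sym; ↭⇒↭ₛ)
open import Data.List.Relation.Binary.Permutation.Propositional.Properties using (All-resp-↭; ↭-reverse)
open import Data.List.Relation.Binary.Permutation.Setoid.Properties using (Unique-resp-↭)
open import Data.Product using (∃; ∃₂; _×_; _,_; proj₁; uncurry)
open import Data.Sum using (_⊎_; inj₁; inj₂)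
open import Function using (_∘_)
open import Function.Bundles using (mk⇔; Equivalence)
open import Relation.Nullary using (yes; no; contradiction)
open import Relation.Binary.Definitions using (tri<; tri≈; tri>)
open import Relation.Binary.PropositionalEquality using (_≡_; _≢_; refl; sym; trans; cong; subst; setoid)

module _ {A : Set} {Q R : A → Set}
         (one-of : ∀ {x y} → R x → R y → x ≢ y → Q x ⊎ Q y) where

  private
    cons-fresh : ∀ {x : A} {vs zs} → x ∉ zs → vs ⊆ zs → Unique vs → Unique (x ∷ vs)
    cons-fresh {vs = vs} x∉zs vs⊆zs u = ¬Any⇒All¬ vs (x∉zs ∘ vs⊆zs) ∷ u

  -- Keep one element aside: comparing it with the next one, either of the two can be released into Q.
  all-but-one : ∀ {x} xs → R x → All R xs → Unique (x ∷ xs) →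
                ∃ λ vs → vs ⊆ x ∷ xs × Unique vs × All Q vs × length vs ≡ length xs
  all-but-one [] _ _ _ = [] , (λ ()) , [] , [] , refl
  all-but-one {x} (y ∷ xs) rx (ry ∷ rxs) uxs@((x≢y ∷ x∉xs) ∷ y∉xs ∷ u) with one-of rx ry x≢y
  ... | inj₁ qx =
    let vs , vs⊆ , uvs , qvs , len = all-but-one xs ry rxs (y∉xs ∷ u)
    in  x ∷ vs , ∷⁺ʳ x vs⊆ , cons-fresh (Unique[x∷xs]⇒x∉xs uxs) vs⊆ uvs , qx ∷ qvs , cong suc len
  ... | inj₂ qy =
    let vs , vs⊆ , uvs , qvs , len = all-but-one xs rx rxs (x∉xs ∷ u)
    in  y ∷ vs , ∈-∷⁺ʳ (there (here refl)) (⊆-trans vs⊆ (∷⁺ʳ x (xs⊆x∷xs xs y)))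
        , cons-fresh y∉x∷xs vs⊆ uvs , qy ∷ qvs , cong suc len
    where
    y∉x∷xs : y ∉ x ∷ xs
    y∉x∷xs (here y≡x) = x≢y (sym y≡x)
    y∉x∷xs (there y∈xs) = Unique[x∷xs]⇒x∉xs (y∉xs ∷ u) y∈xs

  length-≤-suc : ∀ {b} → (∀ {vs} → Unique vs → All Q vs → length vs ≤ b) →
                 ∀ {ws} → Unique ws → All R ws → length ws ≤ suc b
  length-≤-suc bound {[]} _ _ = z≤n
  length-≤-suc bound {x ∷ xs} u (rx ∷ rxs) =
    let vs , _ , uvs , qvs , len = all-but-one xs rx rxs u
    in  s≤s (subst (_≤ _) len (bound uvs qvs))

lookup-injective : ∀ {A : Set} {xs : List A} → Unique xs → ∀ {i j} → lookup xs i ≡ lookup xs j → i ≡ j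
lookup-injective (_ ∷ _) {zero} {zero} _ = refl
lookup-injective (x∉ ∷ _) {zero} {suc j} eq = contradiction eq (All.lookup x∉ (∈-lookup j))
lookup-injective (x∉ ∷ _) {suc i} {zero} eq = contradiction (sym eq) (All.lookup x∉ (∈-lookup i))
lookup-injective (_ ∷ u) {suc i} {suc j} eq = cong suc (lookup-injective u eq)

unique-length-≤ : ∀ {m} {vs : List (Fin m)} → Unique vs → length vs ≤ m
unique-length-≤ {m} {vs} u with length vs ≤? m
... | yes le = le
... | no  gt =
  let i , j , i<j , eq = pigeonhole (≰⇒> gt) (lookup vs)
  in  contradiction (lookup-injective u eq) (Fin.<⇒≢ i<j)

constant-words-≡ : ∀ {A : Set} {a : A} {u v} → All (_≡ a) u → All (_≡ a) v → length u ≡ length v → u ≡ v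
constant-words-≡ [] [] _ = refl
constant-words-≡ (refl ∷ cu) (refl ∷ cv) eq = cong (_ ∷_) (constant-words-≡ cu cv (suc-injective eq))

constant-palindrome : ∀ {s} {a : Alphabet s} {w} → All (_≡ a) w → IsPalindrome w
constant-palindrome {w = w} c =
  constant-words-≡ c (All-resp-↭ (↭-sym (↭-reverse w)) c) (sym (length-reverse w))

blocks-after-constant : ∀ {s} {a : Alphabet s} {w} → All (_≡ a) w → blocks-after a w ≡ 0
blocks-after-constant [] = refl
blocks-after-constant {a = a} (refl ∷ c) with a ≟ a
... | yes _   = blocks-after-constant c
... | no a≢a = contradiction refl a≢a

blocks-after-∷ʳ-≢ : ∀ {s} {a b : Alphabet s} u → b ≢ a → 1 ≤ blocks-after b (u ∷ʳ a)
blocks-after-∷ʳ-≢ {a = a} {b} [] b≢a with b ≟ a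
... | yes b≡a = contradiction b≡a b≢a
... | no _    = s≤s z≤n
blocks-after-∷ʳ-≢ {b = b} (c ∷ u) b≢a with b ≟ c
... | yes refl = blocks-after-∷ʳ-≢ u b≢a
... | no _     = s≤s z≤n

blocks-after-∷ʳ-≤1 : ∀ {s} {a : Alphabet s} u → blocks-after a (u ∷ʳ a) ≤ 1 → All (_≡ a) u
blocks-after-∷ʳ-≤1 [] _ = []
blocks-after-∷ʳ-≤1 {a = a} (b ∷ u) h with a ≟ b
... | yes refl = refl ∷ blocks-after-∷ʳ-≤1 u h
... | no a≢b   = contradiction (≤-trans (blocks-after-∷ʳ-≢ u (a≢b ∘ sym)) (s≤s⁻¹ h)) λ ()

-- A palindrome begins and ends with the same letter, so a second block would force a third.
two-block-palindrome-constant : ∀ {s} {a : Alphabet s} {w} →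
                                blocks (a ∷ w) ≤ 2 → IsPalindrome (a ∷ w) → All (_≡ a) w
two-block-palindrome-constant {a = a} {w} b≤2 pal with reverse w | trans pal (unfold-reverse a w)
... | []    | refl = []
... | c ∷ r | eq with ∷-injectiveʳ eq
... | refl = ++⁺ (blocks-after-∷ʳ-≤1 r (s≤s⁻¹ b≤2)) (refl ∷ [])

≤-suc-≢⇒≤ : ∀ {m} {i : Fin m} {v : Fin (suc m)} → toℕ v ≤ suc (toℕ i) → suc i ≢ v → toℕ v ≤ toℕ i
≤-suc-≢⇒≤ v≤ i≢v with m≤n⇒m<n∨m≡n v≤
... | inj₁ v< = s≤s⁻¹ v<
... | inj₂ v≡ = contradiction (sym (toℕ-injective v≡)) i≢v

module _ {s} {T : Tree s} where

  Adj-sym : ∀ {x y a} → Adj T x y a → Adj T y x a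
  Adj-sym (up i)   = down i
  Adj-sym (down i) = up i

  source∈ : ∀ {x y w vs} → Walk T x y w vs → x ∈ vs
  source∈ (here _)   = here refl
  source∈ (step _ _) = here refl

  walk-length : ∀ {x y w vs} → Walk T x y w vs → length vs ≡ suc (length w)
  walk-length (here _)      = refl
  walk-length (step _ rest) = cong suc (walk-length rest)

  private
    reverse-walk-acc : ∀ {x y z w u vs us} → Walk T x y w vs → Walk T x z u (x ∷ us) →
                       Walk T y z (reverseAcc u w) (reverseAcc us vs)
    reverse-walk-acc (here _)        acc = acc
    reverse-walk-acc (step adj rest) acc = reverse-walk-acc rest (step (Adj-sym adj) acc)

  reverse-walk : ∀ {x y w vs} → Walk T x y w vs → Walk T y x (reverse w) (reverse vs)
  reverse-walk {x} p = reverse-walk-acc p (here x)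

  drop-walk : ∀ {x y w vs} d → d ≤ length w → Walk T x y w vs →
              ∃ λ x′ → Walk T x′ y (drop d w) (drop d vs)
  drop-walk zero    _       p               = _ , p
  drop-walk (suc d) (s≤s d≤) (step _ rest) = drop-walk d d≤ rest

  simple-path-length-≤ : ∀ {x y w vs} → Walk T x y w vs → Unique vs → length w ≤ edges T
  simple-path-length-≤ p u = s≤s⁻¹ (subst (_≤ _) (walk-length p) (unique-length-≤ u))

-- Parents precede their children, so the nodes 0 … k span a subtree of T, in which node k is a leaf.
module _ {s} (T : Tree s) where

  SimplePathWithin : ℕ → Node T → Node T → List (Alphabet s) → Set
  SimplePathWithin k x y w = ∃ λ vs → Walk T x y w vs × Unique vs × All (λ v → toℕ v ≤ k) vs

  PalWithin : ℕ → List (Alphabet s) → Set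
  PalWithin k w = ∃₂ λ x y → SimplePathWithin k x y w × IsPalindrome w

  PathFromLeaf : Fin (edges T) → List (Alphabet s) → Set
  PathFromLeaf i w = ∃ λ y → SimplePathWithin (suc (toℕ i)) (suc i) y w

  open DecMembership (_≟_ {suc (edges T)}) using (_∈?_)

  reverse-path : ∀ {k x y w} → SimplePathWithin k x y w → SimplePathWithin k y x (reverse w)
  reverse-path (vs , p , u , within) =
    reverse vs , reverse-walk p ,
    Unique-resp-↭ (setoid (Node T)) (↭⇒↭ₛ (↭-sym (↭-reverse vs))) u ,
    All-resp-↭ (↭-sym (↭-reverse vs)) within

  par-≤ : ∀ i → toℕ (par T i) ≤ toℕ i
  par-≤ i = subst (_≤ toℕ i) (sym (toℕ-inject≤ (parent T i) _)) (s≤s⁻¹ (toℕ<n (parent T i)))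

  non-ascending-step : ∀ {x y a} → Adj T x y a → toℕ y ≤ toℕ x →
                       ∃ λ j → x ≡ suc j × y ≡ par T j × a ≡ label T j
  non-ascending-step (up j)   _   = j , refl , refl , refl
  non-ascending-step (down j) y≤x = contradiction (≤-trans y≤x (par-≤ j)) (n≮n _)

  leaf-step : ∀ {i y a} → Adj T (suc i) y a → toℕ y ≤ suc (toℕ i) → y ≡ par T i × a ≡ label T i
  leaf-step adj y≤ with non-ascending-step adj y≤
  ... | _ , refl , y≡ , a≡ = y≡ , a≡

  private
    leaf-not-interior : ∀ {i x y a w vs} → Adj T x (suc i) a → Walk T (suc i) y w vs →
                        All (x ≢_) vs → toℕ x ≤ suc (toℕ i) → All (λ v → toℕ v ≤ suc (toℕ i)) vs →
                        suc i ≡ y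
    leaf-not-interior _ (here _) _ _ _ = refl
    leaf-not-interior adj (step adj′ rest) (_ ∷ x≢) x≤ (_ ∷ within) =
      contradiction (trans (proj₁ (leaf-step (Adj-sym adj) x≤)) (sym (proj₁ (leaf-step adj′ z≤))))
                    (All.lookup x≢ (source∈ rest))
      where z≤ = All.lookup within (source∈ rest)

  leaf-on-path-is-endpoint : ∀ {i x y w vs} → Walk T x y w vs → Unique vs →
                             All (λ v → toℕ v ≤ suc (toℕ i)) vs → suc i ∈ vs → suc i ≡ x ⊎ suc i ≡ y
  leaf-on-path-is-endpoint (here _)   _ _ (here i≡x) = inj₁ i≡x
  leaf-on-path-is-endpoint (step _ _) _ _ (here i≡x) = inj₁ i≡x
  leaf-on-path-is-endpoint (step adj rest) (x∉ ∷ u) (x≤ ∷ within) (there i∈)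
    with leaf-on-path-is-endpoint rest u within i∈
  ... | inj₁ refl = inj₂ (leaf-not-interior adj rest x∉ x≤ within)
  ... | inj₂ i≡y  = inj₂ i≡y

  old-or-from-leaf : ∀ {i w} → PalWithin (suc (toℕ i)) w → PalWithin (toℕ i) w ⊎ PathFromLeaf i w
  old-or-from-leaf {i} (x , y , (vs , p , u , within) , pal) with suc i ∈? vs
  ... | no i∉ =
    inj₁ (x , y , (vs , p , u , All.zipWith (uncurry ≤-suc-≢⇒≤) (within , ¬Any⇒All¬ vs i∉)) , pal)
  ... | yes i∈ with leaf-on-path-is-endpoint p u within i∈
  ...   | inj₁ refl = inj₂ (y , vs , p , u , within)
  ...   | inj₂ refl =
    inj₂ (x , subst (SimplePathWithin _ _ x) (sym pal) (reverse-path (vs , p , u , within)))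

  leaf-palindrome-constant : In𝓣 2 T → ∀ {i w} → PathFromLeaf i w → IsPalindrome w → All (_≡ label T i) w
  leaf-palindrome-constant _ {w = []} _ _ = []
  leaf-palindrome-constant T₂ {i} {a ∷ w} (y , vs , step adj rest , u , _ ∷ within) pal
    with leaf-step adj (All.lookup within (source∈ rest))
  ... | _ , refl = refl ∷ two-block-palindrome-constant (T₂ (a ∷ w) (suc i , y , vs , step adj rest , u)) pal

  leaf-path-suffix : ∀ {i y a w} → SimplePathWithin (suc (toℕ i)) (suc i) y (a ∷ w) →
                     ∀ d → d ≤ length w → ∃ λ x → SimplePathWithin (toℕ i) x y (drop d w)
  leaf-path-suffix (_ ∷ vs , step _ rest , i∉ ∷ u , _ ∷ within) d d≤ =
    let x , rest′ = drop-walk d d≤ rest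
    in  x , drop d vs , rest′ , Unique.drop⁺ d u , drop⁺ d (All.zipWith (uncurry ≤-suc-≢⇒≤) (within , i∉))

  shorter-constant-palindrome : ∀ {i a u w} → PathFromLeaf i w → All (_≡ a) u → All (_≡ a) w →
                                length u < length w → PalWithin (toℕ i) u
  shorter-constant-palindrome {u = u} {_ ∷ w} (y , path) cu (_ ∷ cw) (s≤s u≤w) =
    let d = length w ∸ length u
        x , suffix = leaf-path-suffix path d (m∸n≤m (length w) (length u))
        suffix≡u = constant-words-≡ (drop⁺ d cw) cu (trans (length-drop d w) (m∸[m∸n]≡n u≤w))
    in  x , y , subst (SimplePathWithin _ x y) suffix≡u suffix , constant-palindrome cu

  at-most-one-from-leaf : In𝓣 2 T → ∀ i {w₁ w₂} → PalWithin (suc (toℕ i)) w₁ → PalWithin (suc (toℕ i)) w₂ →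
                          w₁ ≢ w₂ → PalWithin (toℕ i) w₁ ⊎ PalWithin (toℕ i) w₂
  at-most-one-from-leaf T₂ i {w₁} {w₂} p₁@(_ , _ , _ , pal₁) p₂@(_ , _ , _ , pal₂) w₁≢w₂
    with old-or-from-leaf p₁ | old-or-from-leaf p₂
  ... | inj₁ old₁ | _        = inj₁ old₁
  ... | inj₂ _    | inj₁ old₂ = inj₂ old₂
  ... | inj₂ leaf₁ | inj₂ leaf₂
    with <-cmp (length w₁) (length w₂)
       | leaf-palindrome-constant T₂ leaf₁ pal₁ | leaf-palindrome-constant T₂ leaf₂ pal₂
  ... | tri< w₁<w₂ _ _ | c₁ | c₂ = inj₁ (shorter-constant-palindrome leaf₂ c₁ c₂ w₁<w₂)
  ... | tri≈ _ w₁≡w₂ _ | c₁ | c₂ = contradiction (constant-words-≡ c₁ c₂ w₁≡w₂) w₁≢w₂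
  ... | tri> _ _ w₂<w₁ | c₁ | c₂ = inj₂ (shorter-constant-palindrome leaf₁ c₂ c₁ w₂<w₁)

  pal-within-0-empty : ∀ {w} → PalWithin 0 w → w ≡ []
  pal-within-0-empty (_ , _ , (_ , here _ , _) , _) = refl
  pal-within-0-empty (_ , _ , (_ , step (up _) _ , _ , () ∷ _) , _)
  pal-within-0-empty (_ , _ , (_ , step (down _) rest , _ , _ ∷ within) , _) =
    contradiction (All.lookup within (source∈ rest)) λ ()

  palindromes-within-≤ : In𝓣 2 T → ∀ k → k ≤ edges T →
                         ∀ {ws} → Unique ws → All (PalWithin k) ws → length ws ≤ suc k
  palindromes-within-≤ _ zero _ {[]}    _ _ = z≤n
  palindromes-within-≤ _ zero _ {_ ∷ []} _ _ = s≤s z≤n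
  palindromes-within-≤ _ zero _ {_ ∷ _ ∷ _} ((w₁≢w₂ ∷ _) ∷ _) (p₁ ∷ p₂ ∷ _) =
    contradiction (trans (pal-within-0-empty p₁) (sym (pal-within-0-empty p₂))) w₁≢w₂
  palindromes-within-≤ T₂ (suc k) k<e with fromℕ< k<e | toℕ-fromℕ< k<e
  ... | i | refl = length-≤-suc (at-most-one-from-leaf T₂ i)
                     (palindromes-within-≤ T₂ (toℕ i) (≤-trans (n≤1+n _) k<e))

  palindrome-count-≤ : In𝓣 2 T → ∀ {m} → HasCard (InPal T) m → m ≤ suc (edges T)
  palindrome-count-≤ T₂ (ws , u , ws⇔ , refl) =
    palindromes-within-≤ T₂ (edges T) ≤-refl u (All.tabulate (pal-within-all ∘ Equivalence.to (ws⇔ _)))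
    where
    pal-within-all : ∀ {w} → InPal T w → PalWithin (edges T) w
    pal-within-all ((x , y , vs , p , u) , pal) =
      x , y , (vs , p , u , All.tabulate λ {v} _ → s≤s⁻¹ (toℕ<n v)) , pal

pathTree : (s n : ℕ) → Tree s
pathTree s n = record { edges = n ; parent = λ i → fromℕ (toℕ i) ; label = λ _ → zero }

module _ (s n : ℕ) where

  private
    P = pathTree s n

    zeros : ℕ → List (Alphabet s)
    zeros j = replicate j zero

  toℕ-par-pathTree : ∀ i → toℕ (par P i) ≡ toℕ i
  toℕ-par-pathTree i = trans (toℕ-inject≤ (fromℕ (toℕ i)) _) (toℕ-fromℕ (toℕ i))

  pathTree-words-constant : ∀ {x y w vs} → Walk P x y w vs → All (_≡ zero) w
  pathTree-words-constant (here _)            = []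
  pathTree-words-constant (step (up _) rest)   = refl ∷ pathTree-words-constant rest
  pathTree-words-constant (step (down _) rest) = refl ∷ pathTree-words-constant rest

  pathTree-∈𝓣₂ : In𝓣 2 P
  pathTree-∈𝓣₂ []      _                   = z≤n
  pathTree-∈𝓣₂ (_ ∷ _) (_ , _ , _ , p , _) with pathTree-words-constant p
  ... | refl ∷ c = s≤s (subst (_≤ 1) (sym (blocks-after-constant c)) z≤n)

  descent : ∀ j (x : Node P) → toℕ x ≡ j → SimplePathWithin P j x zero (zeros j)
  descent zero    zero    refl = zero ∷ [] , here zero , [] ∷ [] , z≤n ∷ []
  descent (suc j) (suc i) x≡j  =
    let vs , p , u , within = descent j (par P i) (trans (toℕ-par-pathTree i) (suc-injective x≡j))
    in  suc i ∷ vs , step (up i) p ,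
        All.map (λ { v≤j refl → n≮n j (subst (_≤ j) x≡j v≤j) }) within ∷ u ,
        ≤-reflexive x≡j ∷ All.map m≤n⇒m≤1+n within

  pathTree-palindromes : HasCard (InPal P) (suc n)
  pathTree-palindromes =
    map zeros (upTo (suc n)) ,
    Unique.map⁺ zeros-injective (Unique.upTo⁺ (suc n)) ,
    (λ w → mk⇔ listed⇒pal listed⇐pal) ,
    trans (length-map zeros (upTo (suc n))) (length-upTo (suc n))
    where
    zeros-injective : ∀ {i j} → zeros i ≡ zeros j → i ≡ j
    zeros-injective {i} {j} eq = trans (sym (length-replicate i)) (trans (cong length eq) (length-replicate j))

    listed⇒pal : ∀ {w} → w ∈ map zeros (upTo (suc n)) → InPal P w
    listed⇒pal w∈ with ∈-map⁻ zeros w∈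
    ... | j , j∈ , refl =
      let j<n+1 = ∈-upTo⁻ j∈
          vs , p , u , _ = descent j (fromℕ< j<n+1) (toℕ-fromℕ< j<n+1)
      in  (fromℕ< j<n+1 , zero , vs , p , u) , constant-palindrome (replicate⁺ j refl)

    listed⇐pal : ∀ {w} → InPal P w → w ∈ map zeros (upTo (suc n))
    listed⇐pal {w} ((_ , _ , vs , p , u) , _) =
      subst (_∈ _) (sym w≡zeros) (∈-map⁺ zeros (∈-upTo⁺ (s≤s (simple-path-length-≤ p u))))
      where
      w≡zeros : w ≡ zeros (length w)
      w≡zeros = constant-words-≡ (pathTree-words-constant p) (replicate⁺ (length w) refl)
                                 (sym (length-replicate (length w)))

proposition1 : (s n : ℕ) → IsMaxPal₂ s n (suc n)
proposition1 s n =
  (λ T T∈𝓣₂ |T|≤n _ card → ≤-trans (palindrome-count-≤ T T∈𝓣₂ card) (s≤s |T|≤n)) ,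
  pathTree s n , pathTree-∈𝓣₂ s n , ≤-refl , pathTree-palindromes s n
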